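{- For every integer $n \geq 4$, \[ l(n) \geq \lceil n/2\rceil\left(\lfloor n/2\rfloor + 1\right) + 1 . \]
   Context: All graphs are finite and simple. For integers $a\le b$, $[a,b]$ denotes the set of integers $x$ with $a\le x\le b$. A graph $G$ is super edge-magic if there is a bijection $f:V(G)\cup E(G)\to[1,|V(G)|+|E(G)|]$ with $f(V(G))=[1,|V(G)|]$ such that $f(u)+f(v)+f(uv)$ is the same constant for every edge $uv\in E(G)$. The super edge-magic deficiency $\mu_s(G)$ of a graph $G$ is the smallest nonnegative integer $k$ such that the disjoint union $G\cup kK_1$ of $G$ with $k$ isolated vertices is super edge-magic, or $+\infty$ if no such $k$ exists. For a positive integer $n$, $l(n)$ denotes the minimum positive integer such that every graph of order $n$ and size at least $l(n)$ satisfies $\mu_s(G)=+\infty$. -}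

module Defs where

open import Data.Nat using (ℕ; suc; _+_; _≤_)
open import Data.Fin using (Fin; toℕ; _↑ˡ_) renaming (_<_ to _<ᶠ_)
open import Data.Product using (Σ; _×_; _,_; proj₁; proj₂)
open import Data.List using (List; length; lookup; map)
open import Data.List.Relation.Unary.All using (All)
open import Data.List.Relation.Unary.Unique.Propositional using (Unique)
open import Function.Bundles using (_⤖_; Bijection)
open import Relation.Binary.PropositionalEquality using (_≡_)
open import Relation.Nullary using (¬_)

-- A finite simple graph of order n: vertex set Fin n, edge set given as a
-- duplicate-free list of pairs (u , v) with u < v (so no loops, and each
-- unordered pair is listed at most once).
record Graph (n : ℕ) : Set where
  field
    edges    : List (Fin n × Fin n)
    ordered  : All (λ e → proj₁ e <ᶠ proj₂ e) edges
    distinct : Unique edges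
open Graph public

size : ∀ {n} → Graph n → ℕ
size G = length (edges G)

-- The total labeling f : V ∪ E → [1, p+q] with
-- f(V) = [1,p] is given by a bijection fv on vertices (vertex u gets label
-- 1 + fv u ∈ [1,p]) and a bijection fe on edges (edge i gets label
-- p + 1 + fe i ∈ [p+1, p+q]); f(u)+f(v)+f(uv) must equal a constant c.
SuperEdgeMagicE : (p : ℕ) → List (Fin p × Fin p) → Set
SuperEdgeMagicE p es =
  Σ (Fin p ⤖ Fin p) λ fv →
  Σ (Fin (length es) ⤖ Fin (length es)) λ fe →
  Σ ℕ λ c →
  ∀ (i : Fin (length es)) →
    suc (toℕ (Bijection.to fv (proj₁ (lookup es i))))
    + suc (toℕ (Bijection.to fv (proj₂ (lookup es i))))
    + (p + suc (toℕ (Bijection.to fe i))) ≡ c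

-- G ∪ k K₁ : vertex set Fin (n + k), the same edges (old vertices embedded
-- via _↑ˡ_), k new isolated vertices.
SuperEdgeMagicWithIsolated : ∀ {n} → Graph n → (k : ℕ) → Set
SuperEdgeMagicWithIsolated {n} G k =
  SuperEdgeMagicE (n + k)
    (map (λ e → (proj₁ e ↑ˡ k) , (proj₂ e ↑ˡ k)) (edges G))

DeficiencyInfinite : ∀ {n} → Graph n → Set
DeficiencyInfinite G = ∀ k → ¬ SuperEdgeMagicWithIsolated G k

-- The property defining l(n): every graph of order n and size ≥ m has
-- μ_s = +∞.  l(n) is the least positive m with this property.
AllInfiniteFromSize : ℕ → ℕ → Set
AllInfiniteFromSize n m = (G : Graph n) → m ≤ size G → DeficiencyInfinite G

-- Split n = A + B with A = ⌈n/2⌉ ≥ 1 and B = ⌊n/2⌋ ≥ 2.  Give vertices x_0, …, x_{A-1} the labels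
-- 0, …, A-1 and vertices y_0, …, y_{B-1} the labels A, 2A, …, BA.  The edges x_0 x_r (0 < r < A),
-- x_r y_q (all r, q) and y_0 y_{B-1} then have the label sums 1, 2, …, A(B+1), each exactly once.
-- The B(A-1) labels skipped between consecutive y's go to isolated vertices, and numbering the edges
-- in decreasing order of their sums makes every edge total equal, so this graph of order n and size
-- A(B+1) has finite super edge-magic deficiency, whence l(n) > A(B+1).
module Submission where

open import Defs
open import Data.Nat using (ℕ; suc; _+_; _*_; _∸_; _≤_; _<_; _≤?_; s≤s; z≤n; ⌈_/2⌉; ⌊_/2⌋)
open import Data.Nat.Properties
  using (+-suc; +-comm; +-identityʳ; +-cancelˡ-≡; +-monoʳ-<; m≤m+n; <-≤-trans; ≤-trans; m+[n∸m]≡n; ≰⇒>;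
         ⌈n/2⌉-mono; ⌊n/2⌋-mono; ⌊n/2⌋+⌈n/2⌉≡n)
open import Data.Nat.Tactic.RingSolver using (solve-∀)
open import Data.Fin using (Fin; toℕ; _↑ˡ_; _↑ʳ_; cast; combine; fromℕ; opposite)
open import Data.Fin.Properties
  using (+↔⊎; *↔×; toℕ-↑ˡ; toℕ-↑ʳ; toℕ-cast; toℕ-combine; toℕ-fromℕ; toℕ<n; toℕ-injective;
         splitAt-↑ˡ; splitAt-↑ʳ; cast-involutive; opposite-prop; opposite-involutive)
open import Data.Product using (_×_; _,_; proj₁; proj₂)
open import Data.Sum using (_⊎_; inj₁; inj₂)
open import Data.Sum.Algebra using (⊎-cong; ⊎-assoc)
open import Data.List using (length; lookup; tabulate)
open import Data.List.Properties using (length-tabulate; lookup-tabulate; map-tabulate)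
open import Data.List.Relation.Unary.All.Properties using (tabulate⁺)
open import Data.List.Relation.Unary.Unique.Propositional.Properties using ()
  renaming (tabulate⁺ to unique-tabulate⁺)
open import Data.Empty using (⊥-elim)
open import Function.Base using (_∘_)
open import Function.Bundles using (_↔_; _⤖_; Bijection; Inverse; mk↔ₛ′)
open import Function.Definitions using (Injective)
open import Function.Properties.Inverse using (↔-refl; ↔-sym; ↔-trans; ↔⇒⤖)
open import Function.Related.Propositional using (bijection; module EquationalReasoning)
open import Level using (0ℓ)
open import Relation.Binary.PropositionalEquality
open import Relation.Nullary using (yes; no)

cast↔ : ∀ {m n} → m ≡ n → Fin m ↔ Fin n
cast↔ eq = mk↔ₛ′ (cast eq) (cast (sym eq)) (cast-involutive eq (sym eq)) (cast-involutive (sym eq) eq)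

⊎×Fin↔×Fin-suc : ∀ {X : Set} m → (X ⊎ X × Fin m) ↔ (X × Fin (suc m))
⊎×Fin↔×Fin-suc {X} m = mk↔ₛ′ to from to∘from from∘to
  where
  to : X ⊎ X × Fin m → X × Fin (suc m)
  to (inj₁ x)       = x , Fin.zero
  to (inj₂ (x , i)) = x , Fin.suc i
  from : X × Fin (suc m) → X ⊎ X × Fin m
  from (x , Fin.zero)  = inj₁ x
  from (x , Fin.suc i) = inj₂ (x , i)
  to∘from : ∀ p → to (from p) ≡ p
  to∘from (x , Fin.zero)  = refl
  to∘from (x , Fin.suc i) = refl
  from∘to : ∀ s → from (to s) ≡ s
  from∘to (inj₁ x)       = refl
  from∘to (inj₂ (x , i)) = refl

lookup-tabulate′ : ∀ {A : Set} {L} (f : Fin L → A) (i : Fin (length (tabulate f))) →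
  lookup (tabulate f) i ≡ f (cast (length-tabulate f) i)
lookup-tabulate′ f i = trans
  (cong (lookup (tabulate f)) (sym (cast-involutive (sym (length-tabulate f)) (length-tabulate f) i)))
  (lookup-tabulate f (cast (length-tabulate f) i))

edgeLabelSum : ∀ {p} → (Fin p → ℕ) → Fin p × Fin p → ℕ
edgeLabelSum ℓ e = ℓ (proj₁ e) + ℓ (proj₂ e)

HasConsecutiveEdgeSums : ∀ {p L} → (Fin p → ℕ) → (Fin L → Fin p × Fin p) → ℕ → Set
HasConsecutiveEdgeSums ℓ e s = ∀ j → edgeLabelSum ℓ (e j) ≡ s + toℕ j

consecutiveEdgeSums⇒injective : ∀ {p L} {ℓ : Fin p → ℕ} {e : Fin L → Fin p × Fin p} {s} →
  HasConsecutiveEdgeSums ℓ e s → Injective _≡_ _≡_ e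
consecutiveEdgeSums⇒injective {ℓ = ℓ} {s = s} sums {i} {j} eᵢ≡eⱼ =
  toℕ-injective (+-cancelˡ-≡ s _ _
    (trans (sym (sums i)) (trans (cong (edgeLabelSum ℓ) eᵢ≡eⱼ) (sums j))))

magicConstant : ∀ x y s i p L → x + y ≡ s + i → i < L →
  suc x + suc y + (p + suc (L ∸ suc i)) ≡ suc (suc (s + p + L))
magicConstant x y s i p L x+y≡s+i i<L = begin
  suc x + suc y + (p + suc d)     ≡⟨ cong (λ z → suc z + (p + suc d)) (+-suc x y) ⟩
  suc (suc (x + y)) + (p + suc d) ≡⟨ cong (λ z → suc (suc z) + (p + suc d)) x+y≡s+i ⟩
  suc (suc (s + i)) + (p + suc d) ≡⟨ regroup s i p d ⟩
  suc (suc (s + p + (suc i + d))) ≡⟨ cong (λ z → suc (suc (s + p + z))) (m+[n∸m]≡n i<L) ⟩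
  suc (suc (s + p + L))           ∎
  where
  open ≡-Reasoning
  d = L ∸ suc i
  regroup : ∀ s i p d → suc (suc (s + i)) + (p + suc d) ≡ suc (suc (s + p + (suc i + d)))
  regroup = solve-∀

consecutiveEdgeSums⇒superEdgeMagic : ∀ {p L} {e : Fin L → Fin p × Fin p} {s}
  (fv : Fin p ⤖ Fin p) → HasConsecutiveEdgeSums (toℕ ∘ Bijection.to fv) e s →
  SuperEdgeMagicE p (tabulate e)
consecutiveEdgeSums⇒superEdgeMagic {p} {e = e} {s} fv sums =
  fv , ↔⇒⤖ reverse , suc (suc (s + p + L)) , magic
  where
  L = length (tabulate e)
  reverse = mk↔ₛ′ opposite opposite opposite-involutive opposite-involutive
  ℓ = toℕ ∘ Bijection.to fv
  magic : ∀ i → suc (ℓ (proj₁ (lookup (tabulate e) i))) + suc (ℓ (proj₂ (lookup (tabulate e) i)))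
                  + (p + suc (toℕ (opposite i))) ≡ suc (suc (s + p + L))
  magic i rewrite lookup-tabulate′ e i | opposite-prop i =
    magicConstant (ℓ (proj₁ (e j))) (ℓ (proj₂ (e j))) s (toℕ i) p L
      (trans (sums (cast (length-tabulate e) i)) (cong (s +_) (toℕ-cast (length-tabulate e) i)))
      (toℕ<n i)
    where j = cast (length-tabulate e) i

tabulatedGraph : ∀ {n L} (e : Fin L → Fin n × Fin n) →
  (∀ j → toℕ (proj₁ (e j)) < toℕ (proj₂ (e j))) → Injective _≡_ _≡_ e → Graph n
tabulatedGraph e ordered injective = record
  { edges = tabulate e ; ordered = tabulate⁺ ordered ; distinct = unique-tabulate⁺ injective }

consecutiveEdgeSums⇒superEdgeMagicWithIsolated : ∀ {n L s} (G : Graph n) {e : Fin L → Fin n × Fin n} →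
  edges G ≡ tabulate e → (k : ℕ) (fv : Fin (n + k) ⤖ Fin (n + k)) →
  HasConsecutiveEdgeSums (λ u → toℕ (Bijection.to fv (u ↑ˡ k))) e s →
  SuperEdgeMagicWithIsolated G k
consecutiveEdgeSums⇒superEdgeMagicWithIsolated {n} G {e} refl k fv sums =
  subst (SuperEdgeMagicE (n + k)) (sym (map-tabulate e _))
    (consecutiveEdgeSums⇒superEdgeMagic fv sums)

superEdgeMagicWithIsolated⇒size< : ∀ {n m} → AllInfiniteFromSize n m →
  (G : Graph n) (k : ℕ) → SuperEdgeMagicWithIsolated G k → size G < m
superEdgeMagicWithIsolated⇒size< {m = m} allInfinite G k magic with m ≤? size G
... | yes m≤size = ⊥-elim (allInfinite G m≤size k magic)
... | no m≰size  = ≰⇒> m≰size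

module Construction (a b : ℕ) where
  A B k : ℕ
  A = suc a
  B = suc (suc b)
  k = B * a

  x : Fin A → Fin (A + B)
  x r = r ↑ˡ B

  y : Fin B → Fin (A + B)
  y q = A ↑ʳ q

  vertexCount : A + B * A ≡ (A + B) + k
  vertexCount = count a b
    where
    count : ∀ a b → suc a + suc (suc b) * suc a ≡ (suc a + suc (suc b)) + suc (suc b) * a
    count = solve-∀

  -- y_q and the a isolated vertices (q , s) share the block of labels A(q+1), …, A(q+1) + a.
  vertexLabelling : Fin ((A + B) + k) ↔ Fin ((A + B) + k)
  vertexLabelling = begin
    Fin ((A + B) + k)                   ↔⟨ +↔⊎ ⟩
    (Fin (A + B) ⊎ Fin (B * a))         ↔⟨ ⊎-cong +↔⊎ *↔× ⟩
    ((Fin A ⊎ Fin B) ⊎ Fin B × Fin a)   ↔⟨ ⊎-assoc 0ℓ _ _ _ ⟩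
    (Fin A ⊎ (Fin B ⊎ Fin B × Fin a))   ↔⟨ ⊎-cong ↔-refl (⊎×Fin↔×Fin-suc a) ⟩
    (Fin A ⊎ Fin B × Fin A)             ↔⟨ ⊎-cong ↔-refl (↔-sym *↔×) ⟩
    (Fin A ⊎ Fin (B * A))               ↔⟨ ↔-sym +↔⊎ ⟩
    Fin (A + B * A)                     ↔⟨ cast↔ vertexCount ⟩
    Fin ((A + B) + k)                   ∎
    where open EquationalReasoning {bijection}

  label : Fin (A + B) → ℕ
  label u = toℕ (Inverse.to vertexLabelling (u ↑ˡ k))

  label-x : ∀ r → label (x r) ≡ toℕ r
  label-x r rewrite splitAt-↑ˡ (A + B) (x r) k | splitAt-↑ˡ A r B =
    trans (toℕ-cast vertexCount _) (toℕ-↑ˡ r _)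

  label-y : ∀ q → label (y q) ≡ A + A * toℕ q
  label-y q rewrite splitAt-↑ˡ (A + B) (y q) k | splitAt-↑ʳ A B q =
    trans (toℕ-cast vertexCount _)
      (trans (toℕ-↑ʳ A _) (cong (A +_) (trans (toℕ-combine q (Fin.zero {a})) (+-identityʳ _))))

  EdgeIndex : Set
  EdgeIndex = (Fin a ⊎ Fin B × Fin A) ⊎ Fin 1

  L : ℕ
  L = (a + B * A) + 1

  edgeIndexing : Fin L ↔ EdgeIndex
  edgeIndexing = ↔-trans +↔⊎ (⊎-cong (↔-trans +↔⊎ (⊎-cong ↔-refl *↔×)) ↔-refl)

  edgeAt : EdgeIndex → Fin (A + B) × Fin (A + B)
  edgeAt (inj₁ (inj₁ r))       = x Fin.zero , x (Fin.suc r)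
  edgeAt (inj₁ (inj₂ (q , r))) = x r , y q
  edgeAt (inj₂ _)              = y Fin.zero , y (fromℕ (suc b))

  edge : Fin L → Fin (A + B) × Fin (A + B)
  edge = edgeAt ∘ Inverse.to edgeIndexing

  edgeAt-ordered : ∀ i → toℕ (proj₁ (edgeAt i)) < toℕ (proj₂ (edgeAt i))
  edgeAt-ordered (inj₁ (inj₁ r)) rewrite toℕ-↑ˡ (Fin.suc r) B = s≤s z≤n
  edgeAt-ordered (inj₁ (inj₂ (q , r))) rewrite toℕ-↑ˡ r B | toℕ-↑ʳ A q =
    <-≤-trans (toℕ<n r) (m≤m+n A (toℕ q))
  edgeAt-ordered (inj₂ _) rewrite toℕ-↑ʳ A (Fin.zero {suc b}) | toℕ-↑ʳ A (fromℕ (suc b)) =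
    +-monoʳ-< A (s≤s z≤n)

  edgeAt-sum : ∀ i → edgeLabelSum label (edgeAt i) ≡ 1 + toℕ (Inverse.from edgeIndexing i)
  edgeAt-sum (inj₁ (inj₁ r))
    rewrite label-x Fin.zero | label-x (Fin.suc r) | toℕ-↑ˡ (r ↑ˡ B * A) 1 | toℕ-↑ˡ r (B * A) = refl
  edgeAt-sum (inj₁ (inj₂ (q , r)))
    rewrite label-x r | label-y q | toℕ-↑ˡ (a ↑ʳ combine q r) 1 | toℕ-↑ʳ a (combine q r) | toℕ-combine q r =
    crossSum a (toℕ q) (toℕ r)
    where
    crossSum : ∀ a q r → r + (suc a + suc a * q) ≡ 1 + (a + (suc a * q + r))
    crossSum = solve-∀
  edgeAt-sum (inj₂ Fin.zero)
    rewrite label-y Fin.zero | label-y (fromℕ (suc b)) | toℕ-fromℕ b | toℕ-↑ʳ (a + B * A) (Fin.zero {0}) =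
    lastSum a b
    where
    lastSum : ∀ a b →
      (suc a + suc a * 0) + (suc a + suc a * suc b) ≡ 1 + ((a + suc (suc b) * suc a) + 0)
    lastSum = solve-∀

  edge-sum : HasConsecutiveEdgeSums label edge 1
  edge-sum j = trans (edgeAt-sum (Inverse.to edgeIndexing j))
                     (cong (suc ∘ toℕ) (Inverse.strictlyInverseʳ edgeIndexing j))

  G : Graph (A + B)
  G = tabulatedGraph edge (edgeAt-ordered ∘ Inverse.to edgeIndexing)
        (consecutiveEdgeSums⇒injective {ℓ = label} edge-sum)

  size-G : size G ≡ A * (B + 1)
  size-G = trans (length-tabulate edge) (edgeCount a b)
    where
    edgeCount : ∀ a b → (a + suc (suc b) * suc a) + 1 ≡ suc a * (suc (suc b) + 1)
    edgeCount = solve-∀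

  G-superEdgeMagic : SuperEdgeMagicWithIsolated G k
  G-superEdgeMagic =
    consecutiveEdgeSums⇒superEdgeMagicWithIsolated G refl k (↔⇒⤖ vertexLabelling) edge-sum

allInfiniteFromSize⇒split-bound : ∀ {n m} A B → 1 ≤ A → 2 ≤ B → A + B ≡ n →
  AllInfiniteFromSize n m → A * (B + 1) < m
allInfiniteFromSize⇒split-bound (suc a) (suc (suc b)) (s≤s _) (s≤s (s≤s _)) refl allInfinite =
  subst (_< _) size-G (superEdgeMagicWithIsolated⇒size< allInfinite G k G-superEdgeMagic)
  where open Construction a b

mainTheorem1 : (n : ℕ) → 4 ≤ n →
    (m : ℕ) → 1 ≤ m → AllInfiniteFromSize n m →
    ⌈ n /2⌉ * (⌊ n /2⌋ + 1) + 1 ≤ m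
mainTheorem1 n 4≤n m _ allInfinite =
  subst (_≤ m) (+-comm 1 _)
    (allInfiniteFromSize⇒split-bound ⌈ n /2⌉ ⌊ n /2⌋
       (≤-trans (s≤s z≤n) (⌈n/2⌉-mono 4≤n)) (⌊n/2⌋-mono 4≤n)
       (trans (+-comm ⌈ n /2⌉ ⌊ n /2⌋) (⌊n/2⌋+⌈n/2⌉≡n n)) allInfinite)
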